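{- Let $G$ be an equitably 4-colorable graph on $n\ge 2$ vertices and let $k\ge 3$, $l\ge 1$ be integers. Then $\chi_{=}(G\circ^l C_{2k})\le 4$.
   Context: All graphs are finite, simple and connected. $C_m$ denotes the cycle on $m$ vertices. A graph is equitably $k$-colorable if its vertex set can be partitioned into $k$ (possibly empty) independent sets $V_1,\dots,V_k$ with $||V_i|-|V_j||\le 1$ for all $i,j$; $\chi_{=}(G)$ is the least $k$ for which $G$ is equitably $k$-colorable. The corona $G\circ H$ is formed from one copy of $G$ and $|V(G)|$ copies of $H$, the $i$-th vertex of $G$ being joined to every vertex of the $i$-th copy of $H$; $G\circ^1 H=G\circ H$ and $G\circ^l H=(G\circ^{l-1}H)\circ H$ for $l\ge 2$. -}

module Defs where

open import Data.Nat using (ℕ; zero; suc; _+_; _*_; _≤_; _≡ᵇ_)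
open import Data.Fin using (Fin; toℕ; splitAt; remQuot; _≟_)
open import Data.Bool using (Bool; true; false; _∧_; _∨_)
open import Data.Sum using (_⊎_; inj₁; inj₂)
open import Data.Product using (Σ; ∃; _×_; _,_)
open import Data.List using (List; length; filter; allFin)
open import Relation.Nullary using (¬_; does)
open import Relation.Binary.PropositionalEquality using (_≡_; _≢_)

record Graph : Set where
  constructor mkGraph
  field
    size : ℕ
    adj  : Fin size → Fin size → Bool
open Graph public

IsSimple : Graph → Set
IsSimple G = (∀ u v → adj G u v ≡ adj G v u) × (∀ v → adj G v v ≡ false)

data Reach (G : Graph) : Fin (size G) → Fin (size G) → Set where
  here : ∀ {u} → Reach G u u
  step : ∀ {u w v} → adj G u w ≡ true → Reach G w v → Reach G u v

IsConnected : Graph → Set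
IsConnected G = ∀ u v → Reach G u v

-- the cycle C_m on vertices 0,…,m-1 (i ~ i+1, and 0 ~ m-1); a cycle for m ≥ 3
cycleAdj : (m : ℕ) → Fin m → Fin m → Bool
cycleAdj m i j =
  (suc (toℕ i) ≡ᵇ toℕ j) ∨ (suc (toℕ j) ≡ᵇ toℕ i)
  ∨ ((toℕ i ≡ᵇ 0) ∧ (suc (toℕ j) ≡ᵇ m))
  ∨ ((toℕ j ≡ᵇ 0) ∧ (suc (toℕ i) ≡ᵇ m))

C : ℕ → Graph
C m = mkGraph m (cycleAdj m)

-- corona G ∘ H: vertices Fin (n + n * m); the first n are the copy of G,
-- vertex (i , h) (encoded via remQuot) is vertex h of the i-th copy of H.
eqᵇ : ∀ {n} → Fin n → Fin n → Bool
eqᵇ i j = does (i ≟ j)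

coronaAdj : (G H : Graph) → Fin (size G + size G * size H) → Fin (size G + size G * size H) → Bool
coronaAdj G H u v with splitAt (size G) u | splitAt (size G) v
... | inj₁ i | inj₁ j = adj G i j
... | inj₁ i | inj₂ q with remQuot {size G} (size H) q
...   | (j , _) = eqᵇ i j
coronaAdj G H u v | inj₂ p | inj₁ j with remQuot {size G} (size H) p
...   | (i , _) = eqᵇ i j
coronaAdj G H u v | inj₂ p | inj₂ q with remQuot {size G} (size H) p | remQuot {size G} (size H) q
...   | (i , h) | (j , h') = eqᵇ i j ∧ adj H h h'

corona : Graph → Graph → Graph
corona G H = mkGraph (size G + size G * size H) (coronaAdj G H)

coronaIter : Graph → Graph → ℕ → Graph
coronaIter G H zero    = G
coronaIter G H (suc l) = corona (coronaIter G H l) H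

-- colorings; the color classes V_i = c⁻¹(i) are the (possibly empty) parts
IsProper : (G : Graph) {k : ℕ} → (Fin (size G) → Fin k) → Set
IsProper G c = ∀ u v → adj G u v ≡ true → c u ≢ c v

classSize : (G : Graph) {k : ℕ} → (Fin (size G) → Fin k) → Fin k → ℕ
classSize G c i = length (filter (λ v → c v ≟ i) (allFin (size G)))

IsEquitable : (G : Graph) {k : ℕ} → (Fin (size G) → Fin k) → Set
IsEquitable G c = ∀ i j → classSize G c i ≤ classSize G c j + 1

EquitablyColorable : Graph → ℕ → Set
EquitablyColorable G k = Σ (Fin (size G) → Fin k) λ c → IsProper G c × IsEquitable G c

-- χ_=(G) ≤ b : the least k with G equitably k-colorable is at most b,
-- i.e. G is equitably k-colorable for some k ≤ b.
EqChromatic≤ : Graph → ℕ → Set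
EqChromatic≤ G b = ∃ λ k → k ≤ b × EquitablyColorable G k

-- Relabel an equitable 4-colouring of G so that the classes of colours 0, …, r-1 have
-- q + 1 vertices and the others q. Colour the cycle C_{2k} hanging at a vertex of colour x
-- with x + 1 on the even positions and x - 1 on the odd ones: summed over the four classes,
-- this circulant pattern adds the same amount to every colour. Only the cycle at the first
-- vertex of each class follows one of a few other recipes, chosen according to r so as to
-- compensate the larger classes. With k = 2f + p, the size of every colour class of the
-- corona is then q times an affine form in f that does not depend on the colour, plus an
-- affine form in f; so equitability reduces to comparing finitely many coefficients, which
-- is decided by evaluation. When q = 0 this needs at least two vertices; as the corona again
-- has at least two vertices, the step iterates to G ∘^l C_{2k}.
module Submission where

open import Defs
open import Data.Bool using (Bool; T; true; false; if_then_else_; _∨_; not)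
open import Data.Bool.Properties as 𝔹 using (T-≡; T-∨; T-∧)
open import Data.Empty using (⊥-elim)
open import Data.Fin using (Fin; toℕ; _↑ˡ_; _↑ʳ_; splitAt; combine; remQuot; _≟_)
open import Data.Fin.Patterns using (0F; 1F; 2F; 3F; 4F)
open import Data.Fin.Permutation using (Permutation′; _⟨$⟩ʳ_; _⟨$⟩ˡ_; inverseˡ; inverseʳ; id; transpose; _∘ₚ_)
open import Data.Fin.Properties using (splitAt-↑ˡ; splitAt-↑ʳ; remQuot-combine; all?; any?)
open import Data.List using (length; filter; tabulate)
open import Data.Nat as ℕ using (ℕ; zero; suc; s≤s; _+_; _*_; _≤_; _<?_; _≤?_; parity)
open import Data.Nat.DivMod using (_/_; _%_; m%n<n; m≡m%n+[m/n]*n)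
open import Data.Nat.Properties hiding (_≟_)
open import Data.Nat.Tactic.RingSolver using (solve-∀)
open import Data.Parity using (Parity; 0ℙ; 1ℙ; _⁻¹)
open import Data.Parity.Properties using (*-homo-*; p≢p⁻¹; ⁻¹-involutive; suc-homo-⁻¹)
open import Data.Product using (Σ; _×_; _,_; proj₁; proj₂; ∃-syntax)
open import Data.Product.Properties using (≡-dec)
open import Data.Sum using (_⊎_; inj₁; inj₂; [_,_]′)
open import Function using (_∘_; _⇔_; mk⇔; Equivalence)
open import Relation.Binary.PropositionalEquality
  using (_≡_; _≢_; ≢-sym; refl; sym; trans; cong; cong₂; subst; subst₂; module ≡-Reasoning)
open import Relation.Nullary using (Dec; yes; no; does; ¬?; _×-dec_; _→-dec_; map′)
open import Relation.Nullary.Decidable using (True; does-⇔; from-yes; toWitness)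
open import Relation.Unary using (Decidable)

open import Algebra.Properties.Semiring.Sum +-*-semiring
  using (sum-syntax; sum-cong-≗; sum-replicate-zero; ∑-distrib-+; *-distribˡ-sum; *-distribʳ-sum)

-- Counting colour classes

[_] : ∀ {p} {P : Set p} → Dec P → ℕ
[ d ] = if does d then 1 else 0

count : ∀ {n K} → (Fin n → Fin K) → Fin K → ℕ
count {n} c i = ∑[ v < n ] [ c v ≟ i ]

length-filter-tabulate : ∀ {n} {A : Set} (g : Fin n → A) {P : A → Set} (P? : Decidable P) →
  length (filter P? (tabulate g)) ≡ ∑[ v < n ] [ P? (g v) ]
length-filter-tabulate {zero}  g P? = refl
length-filter-tabulate {suc n} g P? with does (P? (g 0F))
... | true  = cong suc (length-filter-tabulate (g ∘ Fin.suc) P?)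
... | false = length-filter-tabulate (g ∘ Fin.suc) P?

classSize≡count : ∀ G {K} (c : Fin (size G) → Fin K) i → classSize G c i ≡ count c i
classSize≡count G c i = length-filter-tabulate (λ v → v) (λ v → c v ≟ i)

∑-↑ : ∀ m {n} (f : Fin (m + n) → ℕ) → ∑[ u < m + n ] f u ≡ ∑[ v < m ] f (v ↑ˡ n) + ∑[ w < n ] f (m ↑ʳ w)
∑-↑ zero    f = refl
∑-↑ (suc m) f = trans (cong (f 0F +_) (∑-↑ m (f ∘ Fin.suc))) (sym (+-assoc (f 0F) _ _))

∑-combine : ∀ m n (f : Fin (m * n) → ℕ) → ∑[ u < m * n ] f u ≡ ∑[ i < m ] ∑[ j < n ] f (combine i j)
∑-combine zero    n f = refl
∑-combine (suc m) n f =
  trans (∑-↑ n f) (cong (∑[ j < n ] f (j ↑ˡ m * n) +_) (∑-combine m n (λ w → f (n ↑ʳ w))))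

∑-select : ∀ {K} (y : Fin K) (h : Fin K → ℕ) → ∑[ x < K ] ([ y ≟ x ] * h x) ≡ h y
∑-select {suc K} 0F          h = trans (cong₂ _+_ (+-identityʳ (h 0F)) (sum-replicate-zero K)) (+-identityʳ _)
∑-select {suc K} (Fin.suc y) h = ∑-select y (h ∘ Fin.suc)

∑-count : ∀ {n K} (c : Fin n → Fin K) → ∑[ x < K ] count c x ≡ n
∑-count {zero}  {K} c = sum-replicate-zero K
∑-count {suc n} {K} c = begin
  ∑[ x < K ] ([ c 0F ≟ x ] + count (c ∘ Fin.suc) x)
    ≡⟨ ∑-distrib-+ (λ x → [ c 0F ≟ x ]) (count (c ∘ Fin.suc)) ⟩
  ∑[ x < K ] [ c 0F ≟ x ] + ∑[ x < K ] count (c ∘ Fin.suc) x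
    ≡⟨ cong₂ _+_ ∑-indicator (∑-count (c ∘ Fin.suc)) ⟩
  suc n ∎
  where
  open ≡-Reasoning
  ∑-indicator : ∑[ x < K ] [ c 0F ≟ x ] ≡ 1
  ∑-indicator = trans (sum-cong-≗ {K} (λ x → sym (*-identityʳ _))) (∑-select (c 0F) (λ _ → 1))

count-relabel : ∀ {n K} (π : Permutation′ K) (c : Fin n → Fin K) j →
  count (λ v → π ⟨$⟩ʳ c v) j ≡ count c (π ⟨$⟩ˡ j)
count-relabel π c j =
  sum-cong-≗ (λ v → cong (if_then 1 else 0) (does-⇔ (moved (c v)) (π ⟨$⟩ʳ c v ≟ j) (c v ≟ π ⟨$⟩ˡ j)))
  where
  moved : ∀ x → π ⟨$⟩ʳ x ≡ j ⇔ x ≡ π ⟨$⟩ˡ j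
  moved x = mk⇔ (λ e → trans (sym (inverseˡ π)) (cong (π ⟨$⟩ˡ_) e))
                (λ e → trans (cong (π ⟨$⟩ʳ_) e) (inverseʳ π))

relabel-proper : ∀ G {K} (π : Permutation′ K) {c : Fin (size G) → Fin K} →
  IsProper G c → IsProper G (λ v → π ⟨$⟩ʳ c v)
relabel-proper G π c-proper u v adj e =
  c-proper u v adj (trans (sym (inverseˡ π)) (trans (cong (π ⟨$⟩ˡ_) e) (inverseˡ π)))

equitable⇒balanced : ∀ G {K} {c : Fin (size G) → Fin K} → IsEquitable G c →
  ∀ i j → count c i ≤ count c j + 1
equitable⇒balanced G {c = c} c-equitable i j =
  subst₂ (λ s t → s ≤ t + 1) (classSize≡count G c i) (classSize≡count G c j) (c-equitable i j)

-- First occurrences of colours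

isNew : ∀ {n K} → (Fin K → Bool) → (Fin n → Fin K) → Fin n → Bool
isNew seen c 0F          = not (seen (c 0F))
isNew seen c (Fin.suc v) = isNew (λ x → does (c 0F ≟ x) ∨ seen x) (c ∘ Fin.suc) v

-- The weight of a class of m vertices weighing g false each, except that its first
-- vertex weighs g true if the colour has not been seen before.
classWeight : (Bool → ℕ) → Bool → ℕ → ℕ
classWeight g true  m       = m * g false
classWeight g false zero    = 0
classWeight g false (suc m) = g true + m * g false

classWeight-empty : ∀ g seen → classWeight g seen 0 ≡ 0
classWeight-empty g true  = refl
classWeight-empty g false = refl

classWeight-cons : ∀ {K} g seen (y x : Fin K) m →
  classWeight g seen ([ y ≟ x ] + m) ≡ [ y ≟ x ] * g (not seen) + classWeight g (does (y ≟ x) ∨ seen) m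
classWeight-cons g seen y x m with y ≟ x
classWeight-cons g true  y x m | yes _ = cong (_+ m * g false) (sym (+-identityʳ (g false)))
classWeight-cons g false y x m | yes _ = cong (_+ m * g false) (sym (+-identityʳ (g true)))
... | no _ = refl

∑-isNew : ∀ {n K} (seen : Fin K → Bool) (c : Fin n → Fin K) (g : Fin K → Bool → ℕ) →
  ∑[ v < n ] g (c v) (isNew seen c v) ≡ ∑[ x < K ] classWeight (g x) (seen x) (count c x)
∑-isNew {zero} {K} seen c g =
  sym (trans (sum-cong-≗ {K} (λ x → classWeight-empty (g x) (seen x))) (sum-replicate-zero K))
∑-isNew {suc n} {K} seen c g = begin
  g y (not (seen y)) + ∑[ v < n ] g (c (Fin.suc v)) (isNew seen′ (c ∘ Fin.suc) v)
    ≡⟨ cong₂ _+_ (sym (∑-select y (λ x → g x (not (seen x))))) (∑-isNew seen′ (c ∘ Fin.suc) g) ⟩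
  ∑[ x < K ] ([ y ≟ x ] * g x (not (seen x))) + ∑[ x < K ] classWeight (g x) (seen′ x) (m x)
    ≡⟨ sym (∑-distrib-+ (λ x → [ y ≟ x ] * g x (not (seen x))) _) ⟩
  ∑[ x < K ] ([ y ≟ x ] * g x (not (seen x)) + classWeight (g x) (seen′ x) (m x))
    ≡⟨ sum-cong-≗ {K} (λ x → sym (classWeight-cons (g x) (seen x) y x (m x))) ⟩
  ∑[ x < K ] classWeight (g x) (seen x) (count c x) ∎
  where
  open ≡-Reasoning
  y = c 0F
  seen′ = λ x → does (y ≟ x) ∨ seen x
  m = count (c ∘ Fin.suc)

-- Alternating colourings of even cycles

record Palette (K : ℕ) : Set where
  constructor palette
  field
    even oddFirst oddRest : Fin K
open Palette

-- The odd positions 1, 3, …, 2y - 1 get oddFirst, the later odd positions oddRest.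
alternate : ∀ {K} → Palette K → ℕ → ℕ → Fin K
alternate P y       zero          = even P
alternate P zero    (suc zero)    = oddRest P
alternate P (suc y) (suc zero)    = oddFirst P
alternate P zero    (suc (suc h)) = alternate P zero h
alternate P (suc y) (suc (suc h)) = alternate P y h

ProperAround : ∀ {K} → Fin K → Palette K → Set
ProperAround x P =
  x ≢ even P × x ≢ oddFirst P × x ≢ oddRest P × even P ≢ oddFirst P × even P ≢ oddRest P

properAround? : ∀ {K} (x : Fin K) (P : Palette K) → Dec (ProperAround x P)
properAround? x P = ¬? (x ≟ even P) ×-dec ¬? (x ≟ oddFirst P) ×-dec ¬? (x ≟ oddRest P)
  ×-dec ¬? (even P ≟ oddFirst P) ×-dec ¬? (even P ≟ oddRest P)

alternate-even : ∀ {K} (P : Palette K) y h → parity h ≡ 0ℙ → alternate P y h ≡ even P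
alternate-even P y       zero          e = refl
alternate-even P zero    (suc (suc h)) e = alternate-even P zero h e
alternate-even P (suc y) (suc (suc h)) e = alternate-even P y h e

alternate-odd : ∀ {K} (P : Palette K) y h → parity h ≡ 1ℙ →
  alternate P y h ≡ oddFirst P ⊎ alternate P y h ≡ oddRest P
alternate-odd P zero    (suc zero)    e = inj₂ refl
alternate-odd P (suc y) (suc zero)    e = inj₁ refl
alternate-odd P zero    (suc (suc h)) e = alternate-odd P zero h e
alternate-odd P (suc y) (suc (suc h)) e = alternate-odd P y h e

≢-alternate-odd : ∀ {K} {c : Fin K} P y h → parity h ≡ 1ℙ → c ≢ oddFirst P → c ≢ oddRest P →
  c ≢ alternate P y h
≢-alternate-odd P y h ph c≢o₁ c≢o₂ =
  [ (λ e → subst (_ ≢_) (sym e) c≢o₁) , (λ e → subst (_ ≢_) (sym e) c≢o₂) ]′ (alternate-odd P y h ph)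

alternate-avoids : ∀ {K} {x : Fin K} {P} → ProperAround x P → ∀ y h → x ≢ alternate P y h
alternate-avoids {P = P} (x≢e , x≢o₁ , x≢o₂ , _) y h with parity h in ph
... | 0ℙ = subst (_ ≢_) (sym (alternate-even P y h ph)) x≢e
... | 1ℙ = ≢-alternate-odd P y h ph x≢o₁ x≢o₂

alternate-proper : ∀ {K} {x : Fin K} {P} → ProperAround x P → ∀ y h h' →
  parity h ≡ parity h' ⁻¹ → alternate P y h ≢ alternate P y h'
alternate-proper {P = P} (_ , _ , _ , e≢o₁ , e≢o₂) y h h' opposite with parity h in ph | parity h' in ph'
... | 0ℙ | 1ℙ = subst (_≢ _) (sym (alternate-even P y h ph)) (≢-alternate-odd P y h' ph' e≢o₁ e≢o₂)
... | 1ℙ | 0ℙ = subst (_ ≢_) (sym (alternate-even P y h' ph')) (≢-sym (≢-alternate-odd P y h ph e≢o₁ e≢o₂))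
... | 0ℙ | 0ℙ = ⊥-elim (p≢p⁻¹ 0ℙ opposite)
... | 1ℙ | 1ℙ = ⊥-elim (p≢p⁻¹ 1ℙ opposite)

parity-suc : ∀ n → parity (suc n) ≡ parity n ⁻¹
parity-suc n = trans (sym (⁻¹-involutive _)) (cong _⁻¹ (suc-homo-⁻¹ n))

⁻¹-flip : ∀ {p q : Parity} → p ≡ q ⁻¹ → q ≡ p ⁻¹
⁻¹-flip {q = q} e = trans (sym (⁻¹-involutive q)) (cong _⁻¹ (sym e))

cycleAdj-parity : ∀ m → parity m ≡ 0ℙ → (h h' : Fin m) → T (cycleAdj m h h') →
  parity (toℕ h) ≡ parity (toℕ h') ⁻¹
cycleAdj-parity m pm h h' = neighbours
  where
  a = toℕ h
  b = toℕ h'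
  wrap : ∀ {a b} → a ≡ 0 → suc b ≡ m → parity a ≡ parity b ⁻¹
  wrap {b = b} refl b+1≡m = sym (trans (sym (parity-suc b)) (trans (cong parity b+1≡m) pm))
  neighbours : T (cycleAdj m h h') → parity a ≡ parity b ⁻¹
  neighbours t with Equivalence.to T-∨ t
  ... | inj₁ a+1≡b = ⁻¹-flip (subst (λ n → parity n ≡ parity a ⁻¹) (≡ᵇ⇒≡ (suc a) b a+1≡b) (parity-suc a))
  ... | inj₂ t₁ with Equivalence.to T-∨ t₁
  ...   | inj₁ b+1≡a = subst (λ n → parity n ≡ parity b ⁻¹) (≡ᵇ⇒≡ (suc b) a b+1≡a) (parity-suc b)
  ...   | inj₂ t₂ with Equivalence.to T-∨ t₂
  ...     | inj₁ t₃ with Equivalence.to T-∧ t₃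
  ...       | a≡0 , b+1≡m = wrap (≡ᵇ⇒≡ a 0 a≡0) (≡ᵇ⇒≡ (suc b) m b+1≡m)
  neighbours t | inj₂ t₁ | inj₂ t₂ | inj₂ t₃ with Equivalence.to T-∧ t₃
  ... | b≡0 , a+1≡m = ⁻¹-flip (wrap (≡ᵇ⇒≡ b 0 b≡0) (≡ᵇ⇒≡ (suc a) m a+1≡m))

∑-pairs : ∀ k (f : ℕ → ℕ) → ∑[ h < 2 * suc k ] f (toℕ h) ≡ f 0 + (f 1 + ∑[ h < 2 * k ] f (2 + toℕ h))
∑-pairs k f = cong (λ n → ∑[ h < n ] f (toℕ h)) (*-suc 2 k)

count-alternate : ∀ {K} (P : Palette K) (i : Fin K) k y z → y + z ≡ k →
  ∑[ h < 2 * k ] [ alternate P y (toℕ h) ≟ i ] ≡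
    [ even P ≟ i ] * k + [ oddFirst P ≟ i ] * y + [ oddRest P ≟ i ] * z
count-alternate P i zero zero zero refl = sym (vanish [ even P ≟ i ] [ oddFirst P ≟ i ] [ oddRest P ≟ i ])
  where
  vanish : ∀ a b c → a * 0 + b * 0 + c * 0 ≡ 0
  vanish = solve-∀
count-alternate P i (suc k) y z y+z≡k = begin
  ∑[ h < 2 * suc k ] [ alternate P y (toℕ h) ≟ i ]
    ≡⟨ ∑-pairs k (λ h → [ alternate P y h ≟ i ]) ⟩
  [e] + ([ alternate P y 1 ≟ i ] + ∑[ h < 2 * k ] [ alternate P y (2 + toℕ h) ≟ i ])
    ≡⟨ firstPair y z y+z≡k ⟩
  [e] * suc k + [o₁] * y + [o₂] * z ∎
  where
  open ≡-Reasoning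
  [e] = [ even P ≟ i ]
  [o₁] = [ oddFirst P ≟ i ]
  [o₂] = [ oddRest P ≟ i ]
  firstPair : ∀ y z → y + z ≡ suc k →
    [e] + ([ alternate P y 1 ≟ i ] + ∑[ h < 2 * k ] [ alternate P y (2 + toℕ h) ≟ i ]) ≡
      [e] * suc k + [o₁] * y + [o₂] * z
  firstPair (suc y) z y+z≡k =
    trans (cong (λ n → [e] + ([o₁] + n)) (count-alternate P i k y z (suc-injective y+z≡k)))
          (shift [e] [o₁] [o₂] k y z)
    where
    shift : ∀ a b c k y z → a + (b + (a * k + b * y + c * z)) ≡ a * suc k + b * suc y + c * z
    shift = solve-∀
  firstPair zero .(suc k) refl =
    trans (cong (λ n → [e] + ([o₂] + n)) (count-alternate P i k zero k refl)) (shift [e] [o₁] [o₂] k)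
    where
    shift : ∀ a b c k → a + (c + (a * k + b * 0 + c * k)) ≡ a * suc k + b * 0 + c * suc k
    shift = solve-∀

-- Colourings of coronas with cycles

-- A colouring of C_{2k}; its k odd positions are split into first + rest.
record CycleScheme (K k : ℕ) : Set where
  constructor cycleScheme
  field
    colours    : Palette K
    first rest : ℕ
    first+rest : first + rest ≡ k
open CycleScheme

cycleCount : ∀ {K k} → CycleScheme K k → Fin K → ℕ
cycleCount {k = k} S i =
  [ even (colours S) ≟ i ] * k + [ oddFirst (colours S) ≟ i ] * first S + [ oddRest (colours S) ≟ i ] * rest S

cycleColour : ∀ {n K k} → (Fin n → CycleScheme K k) → Fin n × Fin (2 * k) → Fin K
cycleColour S (v , h) = alternate (colours (S v)) (first (S v)) (toℕ h)

coronaColouring : ∀ {n K k} → (Fin n → Fin K) → (Fin n → CycleScheme K k) → Fin (n + n * (2 * k)) → Fin K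
coronaColouring {n} {k = k} c S u = [ c , cycleColour S ∘ remQuot (2 * k) ]′ (splitAt n u)

true⇒T : ∀ {b} → b ≡ true → T b
true⇒T = Equivalence.from T-≡

eqᵇ⇒≡ : ∀ {n} {i j : Fin n} → T (eqᵇ i j) → i ≡ j
eqᵇ⇒≡ {i = i} {j} t with i ≟ j
... | yes i≡j = i≡j
... | no _    = ⊥-elim t

module _ {n K k} {c : Fin n → Fin K} {S : Fin n → CycleScheme K k}
         (S-proper : ∀ v → ProperAround (c v) (colours (S v))) where

  centre≢cycleColour : ∀ v p → v ≡ proj₁ p → c v ≢ cycleColour S p
  centre≢cycleColour v (.v , h) refl = alternate-avoids (S-proper v) (first (S v)) (toℕ h)

  cycleColour-proper : ∀ p p' → proj₁ p ≡ proj₁ p' → T (cycleAdj (2 * k) (proj₂ p) (proj₂ p')) →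
    cycleColour S p ≢ cycleColour S p'
  cycleColour-proper (v , h) (.v , h') refl adjacent =
    alternate-proper (S-proper v) (first (S v)) (toℕ h) (toℕ h') (cycleAdj-parity (2 * k) (*-homo-* 2 k) h h' adjacent)

coronaColouring-proper : ∀ G {K k} {c : Fin (size G) → Fin K} {S : Fin (size G) → CycleScheme K k} →
  IsProper G c → (∀ v → ProperAround (c v) (colours (S v))) →
  IsProper (corona G (C (2 * k))) (coronaColouring c S)
coronaColouring-proper G {k = k} {c} {S} c-proper S-proper u u' adj
  with splitAt (size G) u | splitAt (size G) u'
... | inj₁ v | inj₁ v' = c-proper v v' adj
... | inj₁ v | inj₂ w' = centre≢cycleColour {S = S} S-proper v (remQuot (2 * k) w') (eqᵇ⇒≡ (true⇒T adj))
... | inj₂ w | inj₁ v' =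
  ≢-sym (centre≢cycleColour {S = S} S-proper v' (remQuot (2 * k) w) (sym (eqᵇ⇒≡ (true⇒T adj))))
... | inj₂ w | inj₂ w' =
  cycleColour-proper {S = S} S-proper (remQuot (2 * k) w) (remQuot (2 * k) w') (eqᵇ⇒≡ (proj₁ both)) (proj₂ both)
  where both = Equivalence.to T-∧ (true⇒T adj)

module _ {n K k} (c : Fin n → Fin K) (S : Fin n → CycleScheme K k) where

  coronaColouring-centre : ∀ v → coronaColouring c S (v ↑ˡ n * (2 * k)) ≡ c v
  coronaColouring-centre v = cong [ c , cycleColour S ∘ remQuot (2 * k) ]′ (splitAt-↑ˡ n v (n * (2 * k)))

  coronaColouring-cycle : ∀ v h → coronaColouring c S (n ↑ʳ combine v h) ≡ cycleColour S (v , h)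
  coronaColouring-cycle v h =
    trans (cong [ c , cycleColour S ∘ remQuot (2 * k) ]′ (splitAt-↑ʳ n (n * (2 * k)) (combine v h)))
          (cong (cycleColour S) (remQuot-combine v h))

  count-coronaColouring : ∀ i → count (coronaColouring c S) i ≡ ∑[ v < n ] ([ c v ≟ i ] + cycleCount (S v) i)
  count-coronaColouring i = begin
    count (coronaColouring c S) i
      ≡⟨ ∑-↑ n (λ u → [ coronaColouring c S u ≟ i ]) ⟩
    ∑[ v < n ] [ coronaColouring c S (v ↑ˡ n * (2 * k)) ≟ i ]
      + ∑[ w < n * (2 * k) ] [ coronaColouring c S (n ↑ʳ w) ≟ i ]
      ≡⟨ cong₂ _+_ (sum-cong-≗ {n} (λ v → cong ([_] ∘ (_≟ i)) (coronaColouring-centre v)))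
                   (∑-combine n (2 * k) (λ w → [ coronaColouring c S (n ↑ʳ w) ≟ i ])) ⟩
    ∑[ v < n ] [ c v ≟ i ] + ∑[ v < n ] ∑[ h < 2 * k ] [ coronaColouring c S (n ↑ʳ combine v h) ≟ i ]
      ≡⟨ cong (∑[ v < n ] [ c v ≟ i ] +_) (sum-cong-≗ {n} λ v → trans
           (sum-cong-≗ {2 * k} (λ h → cong ([_] ∘ (_≟ i)) (coronaColouring-cycle v h)))
           (count-alternate (colours (S v)) i k (first (S v)) (rest (S v)) (first+rest (S v)))) ⟩
    ∑[ v < n ] [ c v ≟ i ] + ∑[ v < n ] cycleCount (S v) i
      ≡⟨ sym (∑-distrib-+ (λ v → [ c v ≟ i ]) (λ v → cycleCount (S v) i)) ⟩
    ∑[ v < n ] ([ c v ≟ i ] + cycleCount (S v) i) ∎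
    where open ≡-Reasoning

-- Class sizes as affine forms

-- (a , b) stands for a * f + b, where the half cycle length is k = 2f + p with p ≤ 1.
Affine : Set
Affine = ℕ × ℕ

⟦_⟧ : Affine → ℕ → ℕ
⟦ a , b ⟧ f = a * f + b

_⊕_ : Affine → Affine → Affine
(a , b) ⊕ (a' , b') = a + a' , b + b'

_⊛_ : ℕ → Affine → Affine
n ⊛ (a , b) = n * a , n * b

infixl 6 _⊕_
infixl 7 _⊛_

⟦⊕⟧ : ∀ u v f → ⟦ u ⊕ v ⟧ f ≡ ⟦ u ⟧ f + ⟦ v ⟧ f
⟦⊕⟧ (a , b) (a' , b') f = distrib a b a' b' f
  where
  distrib : ∀ a b a' b' f → (a + a') * f + (b + b') ≡ a * f + b + (a' * f + b')
  distrib = solve-∀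

⟦⊛⟧ : ∀ n u f → ⟦ n ⊛ u ⟧ f ≡ n * ⟦ u ⟧ f
⟦⊛⟧ n (a , b) f = distrib n a b f
  where
  distrib : ∀ n a b f → n * a * f + n * b ≡ n * (a * f + b)
  distrib = solve-∀

∑ₐ : ∀ {K} → (Fin K → Affine) → Affine
∑ₐ {K} w = ∑[ x < K ] proj₁ (w x) , ∑[ x < K ] proj₂ (w x)

⟦∑ₐ⟧ : ∀ {K} (w : Fin K → Affine) f → ⟦ ∑ₐ w ⟧ f ≡ ∑[ x < K ] ⟦ w x ⟧ f
⟦∑ₐ⟧ {K} w f = begin
  (∑[ x < K ] proj₁ (w x)) * f + ∑[ x < K ] proj₂ (w x)
    ≡⟨ cong (_+ ∑[ x < K ] proj₂ (w x)) (*-distribʳ-sum f (proj₁ ∘ w)) ⟩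
  ∑[ x < K ] (proj₁ (w x) * f) + ∑[ x < K ] proj₂ (w x)
    ≡⟨ sym (∑-distrib-+ (λ x → proj₁ (w x) * f) (proj₂ ∘ w)) ⟩
  ∑[ x < K ] ⟦ w x ⟧ f ∎
  where open ≡-Reasoning

_≼_ : Affine → Affine → Set
(a , b) ≼ (a' , b') = a ≡ a' × b ≤ b' + 1

_≼?_ : ∀ u v → Dec (u ≼ v)
(a , b) ≼? (a' , b') = a ℕ.≟ a' ×-dec b ≤? b' + 1

≼-sound : ∀ {u v} → u ≼ v → ∀ f → ⟦ u ⟧ f ≤ ⟦ v ⟧ f + 1
≼-sound {a , b} {.a , b'} (refl , b≤b'+1) f =
  subst (a * f + b ≤_) (sym (+-assoc (a * f) b' 1)) (+-monoʳ-≤ (a * f) b≤b'+1)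

data Split : Set where
  whole low high : Split

firstₐ restₐ : ℕ → Split → Affine
firstₐ p whole = 2 , p
firstₐ p low   = 1 , 0
firstₐ p high  = 1 , p
restₐ  p whole = 0 , 0
restₐ  p low   = 1 , p
restₐ  p high  = 1 , 0

firstₐ+restₐ : ∀ f p s → ⟦ firstₐ p s ⟧ f + ⟦ restₐ p s ⟧ f ≡ 2 * f + p
firstₐ+restₐ f p whole = +-identityʳ (2 * f + p)
firstₐ+restₐ f p low   = halves f p
  where
  halves : ∀ f p → 1 * f + 0 + (1 * f + p) ≡ 2 * f + p
  halves = solve-∀
firstₐ+restₐ f p high  = halves f p
  where
  halves : ∀ f p → 1 * f + p + (1 * f + 0) ≡ 2 * f + p
  halves = solve-∀

Recipe : Set
Recipe = Palette 4 × Split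

schemeOf : ∀ f p → Recipe → CycleScheme 4 (2 * f + p)
schemeOf f p (P , s) = cycleScheme P (⟦ firstₐ p s ⟧ f) (⟦ restₐ p s ⟧ f) (firstₐ+restₐ f p s)

wheelCount : ℕ → Recipe → Fin 4 → Fin 4 → Affine
wheelCount p (P , s) x i = [ x ≟ i ] ⊛ (0 , 1)
  ⊕ ([ even P ≟ i ] ⊛ (2 , p) ⊕ [ oddFirst P ≟ i ] ⊛ firstₐ p s ⊕ [ oddRest P ≟ i ] ⊛ restₐ p s)

⟦wheelCount⟧ : ∀ f p R x i → ⟦ wheelCount p R x i ⟧ f ≡ [ x ≟ i ] + cycleCount (schemeOf f p R) i
⟦wheelCount⟧ f p (P , s) x i = begin
  ⟦ [ x ≟ i ] ⊛ (0 , 1) ⊕ (E ⊛ (2 , p) ⊕ O₁ ⊛ firstₐ p s ⊕ O₂ ⊛ restₐ p s) ⟧ f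
    ≡⟨ ⟦⊕⟧ ([ x ≟ i ] ⊛ (0 , 1)) _ f ⟩
  ⟦ [ x ≟ i ] ⊛ (0 , 1) ⟧ f + ⟦ E ⊛ (2 , p) ⊕ O₁ ⊛ firstₐ p s ⊕ O₂ ⊛ restₐ p s ⟧ f
    ≡⟨ cong₂ _+_ (trans (⟦⊛⟧ [ x ≟ i ] (0 , 1) f) (*-identityʳ [ x ≟ i ])) cycle ⟩
  [ x ≟ i ] + cycleCount (schemeOf f p (P , s)) i ∎
  where
  open ≡-Reasoning
  E = [ even P ≟ i ]
  O₁ = [ oddFirst P ≟ i ]
  O₂ = [ oddRest P ≟ i ]
  cycle : ⟦ E ⊛ (2 , p) ⊕ O₁ ⊛ firstₐ p s ⊕ O₂ ⊛ restₐ p s ⟧ f ≡ cycleCount (schemeOf f p (P , s)) i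
  cycle = begin
    ⟦ E ⊛ (2 , p) ⊕ O₁ ⊛ firstₐ p s ⊕ O₂ ⊛ restₐ p s ⟧ f
      ≡⟨ ⟦⊕⟧ (E ⊛ (2 , p) ⊕ O₁ ⊛ firstₐ p s) _ f ⟩
    ⟦ E ⊛ (2 , p) ⊕ O₁ ⊛ firstₐ p s ⟧ f + ⟦ O₂ ⊛ restₐ p s ⟧ f
      ≡⟨ cong₂ _+_ (⟦⊕⟧ (E ⊛ (2 , p)) _ f) (⟦⊛⟧ O₂ (restₐ p s) f) ⟩
    ⟦ E ⊛ (2 , p) ⟧ f + ⟦ O₁ ⊛ firstₐ p s ⟧ f + O₂ * ⟦ restₐ p s ⟧ f
      ≡⟨ cong (_+ O₂ * ⟦ restₐ p s ⟧ f) (cong₂ _+_ (⟦⊛⟧ E (2 , p) f) (⟦⊛⟧ O₁ (firstₐ p s) f)) ⟩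
    cycleCount (schemeOf f p (P , s)) i ∎

next prev : Fin 4 → Fin 4
next 0F = 1F
next 1F = 2F
next 2F = 3F
next 3F = 0F
prev 0F = 3F
prev 1F = 0F
prev 2F = 1F
prev 3F = 2F

circulant : Fin 4 → Recipe
circulant x = palette (next x) (prev x) (prev x) , whole

-- Recipes for the first vertex of each class when the first r colour classes are the larger ones.
surplusRecipe : Fin 5 → Fin 4 → Recipe
surplusRecipe 1F 0F = palette 3F 2F 1F , high
surplusRecipe 1F 2F = palette 0F 3F 1F , low
surplusRecipe 1F 3F = palette 2F 0F 1F , low
surplusRecipe 3F 0F = palette 1F 2F 3F , low
surplusRecipe 3F 1F = palette 2F 0F 3F , low
surplusRecipe 3F 2F = palette 0F 1F 3F , low
surplusRecipe r  x  = circulant x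

recipe : Fin 5 → Fin 4 → Bool → Recipe
recipe r x false = circulant x
recipe r x true  = surplusRecipe r x

recipe-proper : ∀ r x b → ProperAround x (proj₁ (recipe r x b))
recipe-proper r x false = from-yes (all? λ x → properAround? x (proj₁ (circulant x))) x
recipe-proper r x true  = from-yes (all? λ r → all? λ x → properAround? x (proj₁ (surplusRecipe r x))) r x

canonical : ℕ → Fin 5 → Fin 4 → ℕ
canonical q r x = q + [ toℕ x <? toℕ r ]

coronaSize : (f p q : ℕ) → Fin 5 → Fin 4 → ℕ
coronaSize f p q r i =
  ∑[ x < 4 ] classWeight (λ b → ⟦ wheelCount p (recipe r x b) x i ⟧ f) false (canonical q r x)

layer : ℕ → Fin 4 → Affine
layer p i = ∑ₐ λ x → wheelCount p (circulant x) x i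

base singletons : ℕ → Fin 5 → Fin 4 → Affine
base p r i = ∑ₐ λ x → wheelCount p (surplusRecipe r x) x i ⊕ [ toℕ x <? toℕ r ] ⊛ wheelCount p (circulant x) x i
singletons p r i = ∑ₐ λ x → [ toℕ x <? toℕ r ] ⊛ wheelCount p (surplusRecipe r x) x i

classWeight-suc : ∀ g q e → classWeight g false (suc q + e) ≡ q * g false + (g true + e * g false)
classWeight-suc g q e = distrib (g true) (g false) q e
  where
  distrib : ∀ t s q e → t + (q + e) * s ≡ q * s + (t + e * s)
  distrib = solve-∀

classWeight-indicator : ∀ {p} {P : Set p} g (d : Dec P) → classWeight g false [ d ] ≡ [ d ] * g true
classWeight-indicator g (yes _) = refl
classWeight-indicator g (no _)  = refl

coronaSize-suc : ∀ f p q r i → coronaSize f p (suc q) r i ≡ q * ⟦ layer p i ⟧ f + ⟦ base p r i ⟧ f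
coronaSize-suc f p q r i = begin
  ∑[ x < 4 ] classWeight (g x) false (suc q + e x)
    ≡⟨ sum-cong-≗ {4} (λ x → classWeight-suc (g x) q (e x)) ⟩
  ∑[ x < 4 ] (q * ⟦ wF x ⟧ f + (⟦ wT x ⟧ f + e x * ⟦ wF x ⟧ f))
    ≡⟨ ∑-distrib-+ (λ x → q * ⟦ wF x ⟧ f) (λ x → ⟦ wT x ⟧ f + e x * ⟦ wF x ⟧ f) ⟩
  ∑[ x < 4 ] (q * ⟦ wF x ⟧ f) + ∑[ x < 4 ] (⟦ wT x ⟧ f + e x * ⟦ wF x ⟧ f)
    ≡⟨ cong₂ _+_ (sym (trans (cong (q *_) (⟦∑ₐ⟧ wF f)) (*-distribˡ-sum q (λ x → ⟦ wF x ⟧ f))))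
                 (sym (trans (⟦∑ₐ⟧ (λ x → wT x ⊕ e x ⊛ wF x) f) (sum-cong-≗ {4} pointwise))) ⟩
  q * ⟦ layer p i ⟧ f + ⟦ base p r i ⟧ f ∎
  where
  open ≡-Reasoning
  g = λ x b → ⟦ wheelCount p (recipe r x b) x i ⟧ f
  e = λ (x : Fin 4) → [ toℕ x <? toℕ r ]
  wF = λ x → wheelCount p (circulant x) x i
  wT = λ x → wheelCount p (surplusRecipe r x) x i
  pointwise : ∀ x → ⟦ wT x ⊕ e x ⊛ wF x ⟧ f ≡ ⟦ wT x ⟧ f + e x * ⟦ wF x ⟧ f
  pointwise x = trans (⟦⊕⟧ (wT x) (e x ⊛ wF x) f) (cong (⟦ wT x ⟧ f +_) (⟦⊛⟧ (e x) (wF x) f))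

coronaSize-zero : ∀ f p r i → coronaSize f p 0 r i ≡ ⟦ singletons p r i ⟧ f
coronaSize-zero f p r i = sym (trans (⟦∑ₐ⟧ (λ x → e x ⊛ wT x) f) (sum-cong-≗ {4} λ x →
  trans (⟦⊛⟧ (e x) (wT x) f)
        (sym (classWeight-indicator (λ b → ⟦ wheelCount p (recipe r x b) x i ⟧ f) (toℕ x <? toℕ r)))))
  where
  e = λ (x : Fin 4) → [ toℕ x <? toℕ r ]
  wT = λ x → wheelCount p (surplusRecipe r x) x i

decided-for-p≤1 : ∀ {P : ℕ → Set} (P? : ∀ p → Dec (P p)) → True (P? 0) → True (P? 1) → ∀ p → p ≤ 1 → P p
decided-for-p≤1 P? P0 P1 0             _        = toWitness P0
decided-for-p≤1 P? P0 P1 1             _        = toWitness P1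
decided-for-p≤1 P? P0 P1 (suc (suc _)) (s≤s ())

layer-uniform : ∀ p → p ≤ 1 → ∀ i j → layer p i ≡ layer p j
layer-uniform = decided-for-p≤1 (λ p → all? λ i → all? λ j → ≡-dec ℕ._≟_ ℕ._≟_ (layer p i) (layer p j)) _ _

base-balanced : ∀ p → p ≤ 1 → ∀ r i j → base p r i ≼ base p r j
base-balanced = decided-for-p≤1 (λ p → all? λ r → all? λ i → all? λ j → base p r i ≼? base p r j) _ _

singletons-balanced : ∀ p → p ≤ 1 → ∀ r → 2 ≤ ∑[ x < 4 ] canonical 0 r x →
  ∀ i j → singletons p r i ≼ singletons p r j
singletons-balanced = decided-for-p≤1 (λ p → all? λ r → 2 ≤? ∑[ x < 4 ] canonical 0 r x →-dec
  all? λ i → all? λ j → singletons p r i ≼? singletons p r j) _ _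

coronaSize-balanced : ∀ f p q r → p ≤ 1 → 2 ≤ ∑[ x < 4 ] canonical q r x →
  ∀ i j → coronaSize f p q r i ≤ coronaSize f p q r j + 1
coronaSize-balanced f p zero r p≤1 2≤n i j =
  subst₂ (λ s t → s ≤ t + 1) (sym (coronaSize-zero f p r i)) (sym (coronaSize-zero f p r j))
    (≼-sound (singletons-balanced p p≤1 r 2≤n i j) f)
coronaSize-balanced f p (suc q) r p≤1 _ i j = begin
  coronaSize f p (suc q) r i
    ≡⟨ coronaSize-suc f p q r i ⟩
  q * ⟦ layer p i ⟧ f + ⟦ base p r i ⟧ f
    ≡⟨ cong (λ s → q * ⟦ s ⟧ f + ⟦ base p r i ⟧ f) (layer-uniform p p≤1 i j) ⟩
  q * ⟦ layer p j ⟧ f + ⟦ base p r i ⟧ f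
    ≤⟨ +-monoʳ-≤ (q * ⟦ layer p j ⟧ f) (≼-sound (base-balanced p p≤1 r i j) f) ⟩
  q * ⟦ layer p j ⟧ f + (⟦ base p r j ⟧ f + 1)
    ≡⟨ sym (+-assoc (q * ⟦ layer p j ⟧ f) _ 1) ⟩
  q * ⟦ layer p j ⟧ f + ⟦ base p r j ⟧ f + 1
    ≡⟨ cong (_+ 1) (sym (coronaSize-suc f p q r j)) ⟩
  coronaSize f p (suc q) r j + 1 ∎
  where open ≤-Reasoning

-- Sorting colour classes by size

twoLevels : ∀ {K} (a : Fin (suc K) → ℕ) → (∀ i j → a i ≤ a j + 1) → ∃[ m ] (∀ x → m ≤ a x × a x ≤ m + 1)
twoLevels a balanced with any? (λ y → a y <? a 0F)
... | yes (y , ay<a0) =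
  a y , λ x → ≤-pred (≤-trans ay<a0 (subst (a 0F ≤_) (+-comm (a x) 1) (balanced 0F x))) , balanced x y
... | no ∄y = a 0F , λ x → ≮⇒≥ (λ ax<a0 → ∄y (x , ax<a0)) , balanced x 0F

level+indicator : ∀ {m a} → m ≤ a → a ≤ m + 1 → (d : Dec (a ≡ suc m)) → a ≡ m + [ d ]
level+indicator {m}     m≤a a≤m+1 (yes a≡m+1) = trans a≡m+1 (+-comm 1 m)
level+indicator {m} {a} m≤a a≤m+1 (no a≢m+1)  =
  trans (≤-antisym (≤-pred (≤∧≢⇒< (subst (a ≤_) (+-comm m 1) a≤m+1) a≢m+1)) m≤a) (sym (+-identityʳ m))

allBool? : ∀ {ℓ} {P : Bool → Set ℓ} → (∀ b → Dec (P b)) → Dec (∀ b → P b)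
allBool? P? =
  map′ (λ (pf , pt) → λ { false → pf ; true → pt }) (λ h → h false , h true) (P? false ×-dec P? true)

surplusPattern : Bool → Bool → Bool → Bool → Fin 4 → Bool
surplusPattern b₀ b₁ b₂ b₃ 0F = b₀
surplusPattern b₀ b₁ b₂ b₃ 1F = b₁
surplusPattern b₀ b₁ b₂ b₃ 2F = b₂
surplusPattern b₀ b₁ b₂ b₃ 3F = b₃

surplusPattern-η : ∀ (b : Fin 4 → Bool) x → surplusPattern (b 0F) (b 1F) (b 2F) (b 3F) x ≡ b x
surplusPattern-η b 0F = refl
surplusPattern-η b 1F = refl
surplusPattern-η b 2F = refl
surplusPattern-η b 3F = refl

sortSurplus : Bool → Bool → Bool → Bool → Permutation′ 4 × Fin 5
sortSurplus false false false false = id , 0F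
sortSurplus true  false false false = id , 1F
sortSurplus false true  false false = transpose 0F 1F , 1F
sortSurplus false false true  false = transpose 0F 2F , 1F
sortSurplus false false false true  = transpose 0F 3F , 1F
sortSurplus true  true  false false = id , 2F
sortSurplus true  false true  false = transpose 1F 2F , 2F
sortSurplus true  false false true  = transpose 1F 3F , 2F
sortSurplus false true  true  false = transpose 0F 2F , 2F
sortSurplus false true  false true  = transpose 0F 3F , 2F
sortSurplus false false true  true  = transpose 0F 2F ∘ₚ transpose 1F 3F , 2F
sortSurplus true  true  true  false = id , 3F
sortSurplus true  true  false true  = transpose 2F 3F , 3F
sortSurplus true  false true  true  = transpose 1F 3F , 3F
sortSurplus false true  true  true  = transpose 0F 3F , 3F
sortSurplus true  true  true  true  = id , 4F

sortSurplus-sorted : ∀ b₀ b₁ b₂ b₃ j → let (π , r) = sortSurplus b₀ b₁ b₂ b₃ in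
  surplusPattern b₀ b₁ b₂ b₃ (π ⟨$⟩ˡ j) ≡ does (toℕ j <? toℕ r)
sortSurplus-sorted = from-yes (allBool? λ b₀ → allBool? λ b₁ → allBool? λ b₂ → allBool? λ b₃ → all? λ j →
  let (π , r) = sortSurplus b₀ b₁ b₂ b₃ in surplusPattern b₀ b₁ b₂ b₃ (π ⟨$⟩ˡ j) 𝔹.≟ does (toℕ j <? toℕ r))

sortLevels : (a : Fin 4 → ℕ) → (∀ i j → a i ≤ a j + 1) →
  Σ (Permutation′ 4) λ π → ∃[ q ] ∃[ r ] ∀ j → a (π ⟨$⟩ˡ j) ≡ canonical q r j
sortLevels a balanced with twoLevels a balanced
... | m , bounds = π , m , r , sorted
  where
  surplus : ∀ x → Dec (a x ≡ suc m)
  surplus x = a x ℕ.≟ suc m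
  b = λ x → does (surplus x)
  π = proj₁ (sortSurplus (b 0F) (b 1F) (b 2F) (b 3F))
  r = proj₂ (sortSurplus (b 0F) (b 1F) (b 2F) (b 3F))
  sorted : ∀ j → a (π ⟨$⟩ˡ j) ≡ canonical m r j
  sorted j = trans (level+indicator (proj₁ (bounds x)) (proj₂ (bounds x)) (surplus x))
    (cong (λ t → m + (if t then 1 else 0))
          (trans (sym (surplusPattern-η b x)) (sortSurplus-sorted (b 0F) (b 1F) (b 2F) (b 3F) j)))
    where x = π ⟨$⟩ˡ j

-- The equitable colouring of the corona

module _ (G : Graph) (f p : ℕ) (r : Fin 5) (c : Fin (size G) → Fin 4) where

  surplusSchemes : Fin (size G) → CycleScheme 4 (2 * f + p)
  surplusSchemes v = schemeOf f p (recipe r (c v) (isNew (λ _ → false) c v))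

  surplusSchemes-proper : ∀ v → ProperAround (c v) (colours (surplusSchemes v))
  surplusSchemes-proper v = recipe-proper r (c v) (isNew (λ _ → false) c v)

  classSize-surplusColouring : ∀ q → (∀ x → count c x ≡ canonical q r x) → ∀ i →
    classSize (corona G (C (2 * (2 * f + p)))) (coronaColouring c surplusSchemes) i ≡ coronaSize f p q r i
  classSize-surplusColouring q counts i = begin
    classSize (corona G (C (2 * (2 * f + p)))) (coronaColouring c surplusSchemes) i
      ≡⟨ classSize≡count (corona G (C (2 * (2 * f + p)))) (coronaColouring c surplusSchemes) i ⟩
    count (coronaColouring c surplusSchemes) i
      ≡⟨ count-coronaColouring c surplusSchemes i ⟩
    ∑[ v < size G ] ([ c v ≟ i ] + cycleCount (surplusSchemes v) i)
      ≡⟨ sum-cong-≗ {size G} (λ v → sym (⟦wheelCount⟧ f p (recipe r (c v) (isNew (λ _ → false) c v)) (c v) i)) ⟩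
    ∑[ v < size G ] g (c v) (isNew (λ _ → false) c v)
      ≡⟨ ∑-isNew (λ _ → false) c g ⟩
    ∑[ x < 4 ] classWeight (g x) false (count c x)
      ≡⟨ sum-cong-≗ {4} (λ x → cong (classWeight (g x) false) (counts x)) ⟩
    coronaSize f p q r i ∎
    where
    open ≡-Reasoning
    g = λ x b → ⟦ wheelCount p (recipe r x b) x i ⟧ f

  surplusColouring-equitable : ∀ q → p ≤ 1 → 2 ≤ size G → (∀ x → count c x ≡ canonical q r x) →
    IsEquitable (corona G (C (2 * (2 * f + p)))) (coronaColouring c surplusSchemes)
  surplusColouring-equitable q p≤1 2≤n counts i j =
    subst₂ (λ s t → s ≤ t + 1) (sym (classSize-surplusColouring q counts i))
      (sym (classSize-surplusColouring q counts j)) (coronaSize-balanced f p q r p≤1 2≤total i j)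
    where
    2≤total : 2 ≤ ∑[ x < 4 ] canonical q r x
    2≤total = subst (2 ≤_) (trans (sym (∑-count c)) (sum-cong-≗ {4} counts)) 2≤n

halve : ∀ k → ∃[ f ] ∃[ p ] p ≤ 1 × 2 * f + p ≡ k
halve k = k / 2 , k % 2 , ≤-pred (m%n<n k 2) ,
  trans (trans (+-comm (2 * (k / 2)) (k % 2)) (cong (k % 2 +_) (*-comm 2 (k / 2)))) (sym (m≡m%n+[m/n]*n k 2))

corona-equitable : ∀ G → 2 ≤ size G → EquitablyColorable G 4 → ∀ k →
  EquitablyColorable (corona G (C (2 * k))) 4
corona-equitable G 2≤n (c , c-proper , c-equitable) k
  with halve k | sortLevels (count c) (equitable⇒balanced G c-equitable)
... | f , p , p≤1 , refl | π , q , r , sorted =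
  coronaColouring c′ S ,
  coronaColouring-proper G {S = S} (relabel-proper G π c-proper) (surplusSchemes-proper G f p r c′) ,
  surplusColouring-equitable G f p r c′ q p≤1 2≤n (λ x → trans (count-relabel π c x) (sorted x))
  where
  c′ : Fin (size G) → Fin 4
  c′ v = π ⟨$⟩ʳ c v
  S = surplusSchemes G f p r c′

2≤size-coronaIter : ∀ G H → 2 ≤ size G → ∀ l → 2 ≤ size (coronaIter G H l)
2≤size-coronaIter G H 2≤n zero    = 2≤n
2≤size-coronaIter G H 2≤n (suc l) = ≤-trans (2≤size-coronaIter G H 2≤n l) (m≤m+n _ _)

coronaIter-equitable : ∀ G → 2 ≤ size G → EquitablyColorable G 4 → ∀ k l →
  EquitablyColorable (coronaIter G (C (2 * k)) l) 4
coronaIter-equitable G 2≤n ec k zero    = ec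
coronaIter-equitable G 2≤n ec k (suc l) =
  corona-equitable _ (2≤size-coronaIter G (C (2 * k)) 2≤n l) (coronaIter-equitable G 2≤n ec k l) k

theorem3 : (G : Graph) → IsSimple G → IsConnected G → 2 ≤ size G →
    EquitablyColorable G 4 → (k l : ℕ) → 3 ≤ k → 1 ≤ l →
    EqChromatic≤ (coronaIter G (C (2 * k)) l) 4
theorem3 G _ _ 2≤n ec k l _ _ = 4 , ≤-refl , coronaIter-equitable G 2≤n ec k l
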